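{- Let $n$ be a positive integer and let $p,q,p',q'$ be positive integers with $p+q=p'+q'$. Then $c(p,q,n)=c(p',q',n)$, where $c(p,q,n)$ denotes the number of planted trees on $n+1$ vertices having exactly $p$ crucial vertices and whose root has exactly $q$ children.
   Context: A planted tree is a rooted tree in which the children of each vertex are linearly ordered (counted up to isomorphism preserving these orders). The generation of a vertex is its depth minus one (the root is in generation $-1$). Within a generation, vertices are ordered by birth order, which is the order in which they are visited by the depth-first preorder traversal (children visited in their linear order); the youngest member of a generation is the last in this order. A vertex $v$ is crucial if $v$ is the youngest member of its generation, $v$ has at least one child, and all other members of its generation have no children. -}

module Defs where

open import Data.Nat using (ℕ; zero; suc; _+_)
open import Data.Bool using (Bool; true; false; _∧_; not)
open import Data.List using (List; []; _∷_; _++_; reverse; length; upTo; filterᵇ)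
open import Data.Product using (Σ; _×_)
open import Relation.Binary.PropositionalEquality using (_≡_)

-- Planted (ordered, rooted) trees: a vertex together with the ordered
-- list of its children.  Terms of this type are exactly the planted
-- trees up to order-preserving isomorphism.
data Tree : Set where
  node : List Tree → Tree

children : Tree → List Tree
children (node ts) = ts

rootDegree : Tree → ℕ
rootDegree t = length (children t)

mutual
  size : Tree → ℕ
  size (node ts) = suc (sizes ts)

  sizes : List Tree → ℕ
  sizes []       = 0
  sizes (t ∷ ts) = size t + sizes ts

-- the vertices (as subtrees) at depth d, in birth order
-- (= depth-first preorder order, children in their linear order).
-- Depth d corresponds to generation d - 1; depth 0 is the root (generation -1).
mutual
  atDepth : ℕ → Tree → List Tree
  atDepth zero    t         = t ∷ []
  atDepth (suc d) (node ts) = atDepthList d ts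

  atDepthList : ℕ → List Tree → List Tree
  atDepthList d []       = []
  atDepthList d (t ∷ ts) = atDepth d t ++ atDepthList d ts

hasChild : Tree → Bool
hasChild (node [])      = false
hasChild (node (_ ∷ _)) = true

allChildless : List Tree → Bool
allChildless []       = true
allChildless (v ∷ vs) = not (hasChild v) ∧ allChildless vs

-- Given a generation (list in birth order), does its youngest member
-- (the last one) exist, have at least one child, with all other members childless?
-- (Such a vertex is crucial; each generation has at most one crucial vertex.)
hasCrucial : List Tree → Bool
hasCrucial gen with reverse gen
... | []           = false
... | youngest ∷ others = hasChild youngest ∧ allChildless others

-- number of crucial vertices: count the generations (depths 0 .. size t - 1,
-- which cover all vertices) containing a crucial vertex.
crucialCount : Tree → ℕ
crucialCount t = length (filterᵇ (λ d → hasCrucial (atDepth d t)) (upTo (size t)))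

C : ℕ → ℕ → ℕ → Set
C p q n = Σ Tree (λ t → (size t ≡ suc n) × (crucialCount t ≡ p) × (rootDegree t ≡ q))

module Submission where

-- A planted tree  node F  is determined by the forest F of its root's
-- subtrees, so c(p,q,n) counts forests F with  sizes F = n,  length F = q
-- and  crucialCount (node F) = p.  The proof transports this count, by
-- explicit bijections, to a statistic that is visibly "shiftable".
--
-- 1. The level transform φ rebuilds a forest generation by generation: the
--    degree sequence of every generation is kept, but instead of placing the
--    subtrees of a generation side by side (glue) they are nested into each
--    other (fill).  φ is a size- and length-preserving bijection on forests,
--    with inverse ψ obtained by cutting the nested generations apart again.
-- 2. The spine of a forest is the length of the path that starts at the root
--    of its last tree and always descends to the last child.  The key
--    identity is  crucialCount (node F) = spine (φ F):  each crucial
--    generation adds one vertex to the spine of the nested forest.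
-- 3. Moving the last vertex of the spine out to a new last tree is a
--    bijection between forests with (spine p + 1, q trees) and
--    (spine p, q + 1 trees), for p, q ≥ 1.
-- Hence c(p,q,n) equals the number of forests of size n with spine 1 and
-- p + q - 1 trees, which depends on p and q only through p + q.

open import Defs
open import Data.Nat using (ℕ; _+_; _≤_)
open import Relation.Binary.PropositionalEquality using (_≡_)
open import Function.Bundles using (_↔_)

open import Data.Nat using (zero; suc; _∸_; _<_; z≤n; s≤s; s≤s⁻¹)
open import Data.Nat.Properties
open import Data.Nat.ListAction using (sum)
open import Data.Bool using (Bool; true; false; _∧_; _∨_; not)
open import Data.Bool.Properties using (∧-identityʳ; ∧-comm; ∨-zeroʳ)
open import Data.List
  using (List; []; _∷_; _++_; _∷ʳ_; length; map; take; drop; reverse;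
         filterᵇ; applyUpTo; initLast; _∷ʳ′_)
open import Data.List.Properties
  using (length-take; length-drop; take++drop≡id; take-all; drop-all;
         ++-identityʳ; ++-assoc; length-++; length-++-≤ʳ; length-map; map-++; reverse-++;
         unfold-reverse)
open import Data.Product using (Σ; _×_; _,_; proj₁; proj₂)
open import Relation.Binary.PropositionalEquality
  using (refl; sym; trans; cong; cong₂; subst; module ≡-Reasoning)
open import Relation.Nullary.Irrelevant using (Irrelevant)
open import Function.Bundles using (mk↔ₛ′)
open import Function.Properties.Inverse using (↔-refl; ↔-trans; ↔-sym)

take-length-++ : {A : Set} (xs ys : List A) → take (length xs) (xs ++ ys) ≡ xs
take-length-++ []       ys = refl
take-length-++ (x ∷ xs) ys = cong (x ∷_) (take-length-++ xs ys)

drop-length-++ : {A : Set} (xs ys : List A) → drop (length xs) (xs ++ ys) ≡ ys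
drop-length-++ []       ys = refl
drop-length-++ (x ∷ xs) ys = drop-length-++ xs ys

length-take-≤ : {A : Set} (k : ℕ) (xs : List A) → k ≤ length xs → length (take k xs) ≡ k
length-take-≤ k xs k≤ = trans (length-take k xs) (m≤n⇒m⊓n≡m k≤)

length-drop-+ : {A : Set} (k s : ℕ) (xs : List A) → k + s ≡ length xs → s ≡ length (drop k xs)
length-drop-+ k s xs eq =
  trans (sym (m+n∸m≡n k s)) (trans (cong (_∸ k) eq) (sym (length-drop k xs)))

sizes-++ : (A B : List Tree) → sizes (A ++ B) ≡ sizes A + sizes B
sizes-++ []      B = refl
sizes-++ (t ∷ A) B = trans (cong (size t +_) (sizes-++ A B)) (sym (+-assoc (size t) (sizes A) (sizes B)))

sizes-take-drop : (k : ℕ) (S : List Tree) → sizes (take k S) + sizes (drop k S) ≡ sizes S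
sizes-take-drop k S = trans (sym (sizes-++ (take k S) (drop k S))) (cong sizes (take++drop≡id k S))

degs : List Tree → List ℕ
degs = map rootDegree

kids : List Tree → List Tree
kids []            = []
kids (node C ∷ F) = C ++ kids F

kids-++ : (A B : List Tree) → kids (A ++ B) ≡ kids A ++ kids B
kids-++ []            B = refl
kids-++ (node C ∷ A) B = trans (cong (C ++_) (kids-++ A B)) (sym (++-assoc C (kids A) (kids B)))

kids-snoc : (F C : List Tree) → kids (F ∷ʳ node C) ≡ kids F ++ C
kids-snoc F C = trans (kids-++ F (node C ∷ [])) (cong (kids F ++_) (++-identityʳ C))

length-kids : (F : List Tree) → length (kids F) ≡ sum (degs F)
length-kids []            = refl
length-kids (node C ∷ F) = trans (length-++ C) (cong (length C +_) (length-kids F))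

sizes-kids : (F : List Tree) → sizes F ≡ length F + sizes (kids F)
sizes-kids []            = refl
sizes-kids (node C ∷ F) = cong suc (begin
    sizes C + sizes F                        ≡⟨ cong (sizes C +_) (sizes-kids F) ⟩
    sizes C + (length F + sizes (kids F))    ≡⟨ x+[y+z]≡y+[x+z] (sizes C) (length F) (sizes (kids F)) ⟩
    length F + (sizes C + sizes (kids F))    ≡⟨ cong (length F +_) (sym (sizes-++ C (kids F))) ⟩
    length F + sizes (C ++ kids F)           ∎)
  where
  open ≡-Reasoning
  x+[y+z]≡y+[x+z] : ∀ x y z → x + (y + z) ≡ y + (x + z)
  x+[y+z]≡y+[x+z] x y z =
    trans (sym (+-assoc x y z)) (trans (cong (_+ z) (+-comm x y)) (+-assoc y x z))

kids-shrinks : (f : ℕ) (F : List Tree) → sizes F ≤ suc f → sizes (kids F) ≤ f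
kids-shrinks f []      _ = z≤n
kids-shrinks f (t ∷ F) F≤ =
  s≤s⁻¹ (≤-trans (s≤s (m≤n+m (sizes (kids (t ∷ F))) (length F)))
                 (≤-trans (≤-reflexive (sym (sizes-kids (t ∷ F)))) F≤))

sizes-zero : (F : List Tree) → sizes F ≤ 0 → F ≡ []
sizes-zero []            _ = refl
sizes-zero (node C ∷ F) ()

glue : List ℕ → List Tree → List Tree
glue []      G = []
glue (x ∷ c) G = node (take x G) ∷ glue c (drop x G)

length-glue : (c : List ℕ) (G : List Tree) → length (glue c G) ≡ length c
length-glue []      G = refl
length-glue (x ∷ c) G = cong suc (length-glue c (drop x G))

glue-degs-kids : (F : List Tree) → glue (degs F) (kids F) ≡ F
glue-degs-kids []            = refl
glue-degs-kids (node C ∷ F) =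
  cong₂ (λ C′ F′ → node C′ ∷ F′)
        (take-length-++ C (kids F))
        (trans (cong (glue (degs F)) (drop-length-++ C (kids F))) (glue-degs-kids F))

degs-glue : (c : List ℕ) (G : List Tree) → sum c ≡ length G → degs (glue c G) ≡ c
degs-glue []      G eq = refl
degs-glue (x ∷ c) G eq =
  cong₂ _∷_ (length-take-≤ x G (≤-trans (m≤m+n x (sum c)) (≤-reflexive eq)))
            (degs-glue c (drop x G) (length-drop-+ x (sum c) G eq))

kids-glue : (c : List ℕ) (G : List Tree) → sum c ≡ length G → kids (glue c G) ≡ G
kids-glue []      []      eq = refl
kids-glue (x ∷ c) G       eq =
  trans (cong (take x G ++_) (kids-glue c (drop x G) (length-drop-+ x (sum c) G eq)))
        (take++drop≡id x G)

sizes-glue : (c : List ℕ) (G : List Tree) → sum c ≡ length G → sizes (glue c G) ≡ length c + sizes G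
sizes-glue c G eq = trans (sizes-kids (glue c G))
  (cong₂ _+_ (length-glue c G) (cong sizes (kids-glue c G eq)))

-- Nested reassembly: graft x S makes a new root adopting the first x trees
-- of S, and fill c R grafts the degrees of c from right to left, so that the
-- earlier roots adopt the trees built by the later ones.

graft : ℕ → List Tree → List Tree
graft x S = node (take x S) ∷ drop x S

fill : List ℕ → List Tree → List Tree
fill []      R = R
fill (x ∷ c) R = graft x (fill c R)

fill-++ : (a b : List ℕ) (R : List Tree) → fill (a ++ b) R ≡ fill a (fill b R)
fill-++ []      b R = refl
fill-++ (x ∷ a) b R = cong (graft x) (fill-++ a b R)

length-graft : (x : ℕ) (S : List Tree) → x ≤ length S → length (graft x S) + x ≡ suc (length S)
length-graft x S x≤ = cong suc (trans (cong (_+ x) (length-drop x S)) (m∸n+n≡m x≤))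

-- Each graft consumes x trees and produces one, provided enough are available.
length-fill : (c : List ℕ) (R : List Tree) → sum c ≤ length R →
              length (fill c R) + sum c ≡ length R + length c
length-fill []      R _  = trans (+-identityʳ _) (sym (+-identityʳ _))
length-fill (x ∷ c) R c≤ = begin
    length (graft x S) + (x + sum c)    ≡⟨ sym (+-assoc (length (graft x S)) x (sum c)) ⟩
    length (graft x S) + x + sum c      ≡⟨ cong (_+ sum c) (length-graft x S x≤S) ⟩
    suc (length S + sum c)              ≡⟨ cong suc IH ⟩
    suc (length R + length c)           ≡⟨ sym (+-suc (length R) (length c)) ⟩
    length R + suc (length c)           ∎
  where
  open ≡-Reasoning
  S = fill c R
  IH : length S + sum c ≡ length R + length c
  IH = length-fill c R (≤-trans (m≤n+m (sum c) x) c≤)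
  x≤S : x ≤ length S
  x≤S = +-cancelʳ-≤ (sum c) x (length S)
          (≤-trans c≤ (≤-trans (m≤m+n (length R) (length c)) (≤-reflexive (sym IH))))

fill-room : (x : ℕ) (c : List ℕ) (R : List Tree) → x + sum c ≤ length R → x ≤ length (fill c R)
fill-room x c R le = +-cancelʳ-≤ (sum c) x (length (fill c R))
  (≤-trans le (≤-trans (m≤m+n (length R) (length c))
    (≤-reflexive (sym (length-fill c R (≤-trans (m≤n+m (sum c) x) le))))))

length-fill-exact : (c : List ℕ) (R : List Tree) → sum c ≡ length R → length (fill c R) ≡ length c
length-fill-exact c R eq = +-cancelʳ-≡ (sum c) _ _
  (trans (length-fill c R (≤-reflexive eq))
         (trans (+-comm (length R) (length c)) (cong (length c +_) (sym eq))))

sizes-fill : (c : List ℕ) (R : List Tree) → sizes (fill c R) ≡ length c + sizes R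
sizes-fill []      R = refl
sizes-fill (x ∷ c) R = cong suc (trans (sizes-take-drop x (fill c R)) (sizes-fill c R))

-- cut k H undoes k grafts: it detaches the first root k times, recording its
-- degree and putting its children back in front of the remaining trees.
cut : ℕ → List Tree → List ℕ × List Tree
cut zero    H              = [] , H
cut (suc k) []             = [] , []
cut (suc k) (node C ∷ H) = length C ∷ proj₁ (cut k (C ++ H)) , proj₂ (cut k (C ++ H))

cut-fill : (c : List ℕ) (R : List Tree) → sum c ≤ length R → cut (length c) (fill c R) ≡ (c , R)
cut-fill []      R _ = refl
cut-fill (x ∷ c) R c≤
  rewrite take++drop≡id x (fill c R)
        | cut-fill c R (≤-trans (m≤n+m (sum c) x) c≤)
        | length-take-≤ x (fill c R) (fill-room x c R c≤) = refl

record CutSpec (k : ℕ) (H : List Tree) : Set where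
  field
    fill-cut    : fill (proj₁ (cut k H)) (proj₂ (cut k H)) ≡ H
    length-cut  : length (proj₁ (cut k H)) ≡ k
    length-rest : length (proj₂ (cut k H)) + k ≡ length H + sum (proj₁ (cut k H))
    sizes-rest  : sizes (proj₂ (cut k H)) + k ≡ sizes H

cut-spec : (k : ℕ) (H : List Tree) → k ≤ sizes H → CutSpec k H
cut-spec zero    H            _  = record
  { fill-cut = refl ; length-cut = refl ; length-rest = refl ; sizes-rest = +-identityʳ (sizes H) }
cut-spec (suc k) (node C ∷ H) k≤ = record
  { fill-cut    = cong₂ (λ C′ H′ → node C′ ∷ H′)
                        (trans (cong (take (length C)) IH.fill-cut) (take-length-++ C H))
                        (trans (cong (drop (length C)) IH.fill-cut) (drop-length-++ C H))
  ; length-cut  = cong suc IH.length-cut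
  ; length-rest = begin
      length R + suc k                   ≡⟨ +-suc (length R) k ⟩
      suc (length R + k)                 ≡⟨ cong suc IH.length-rest ⟩
      suc (length (C ++ H) + sum c)      ≡⟨ cong (λ m → suc (m + sum c)) (trans (length-++ C) (+-comm (length C) (length H))) ⟩
      suc (length H + length C + sum c)  ≡⟨ cong suc (+-assoc (length H) (length C) (sum c)) ⟩
      suc (length H + (length C + sum c)) ∎
  ; sizes-rest  = trans (+-suc (sizes R) k) (cong suc (trans IH.sizes-rest (sizes-++ C H)))
  }
  where
  open ≡-Reasoning
  module IH = CutSpec (cut-spec k (C ++ H) (subst (k ≤_) (sym (sizes-++ C H)) (s≤s⁻¹ k≤)))
  c = proj₁ (cut k (C ++ H))
  R = proj₂ (cut k (C ++ H))

-- Peeling off the top generation: cut as many times as there are trees.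
peelDegs : List Tree → List ℕ
peelDegs H = proj₁ (cut (length H) H)

peelRest : List Tree → List Tree
peelRest H = proj₂ (cut (length H) H)

peel-spec : (H : List Tree) → CutSpec (length H) H
peel-spec H = cut-spec (length H) H
  (≤-trans (m≤m+n (length H) (sizes (kids H))) (≤-reflexive (sym (sizes-kids H))))

sum-peelDegs : (H : List Tree) → sum (peelDegs H) ≡ length (peelRest H)
sum-peelDegs H = +-cancelˡ-≡ (length H) _ _
  (trans (sym (CutSpec.length-rest (peel-spec H))) (+-comm (length (peelRest H)) (length H)))

peelRest-shrinks : (f : ℕ) (H : List Tree) → sizes H ≤ suc f → sizes (peelRest H) ≤ f
peelRest-shrinks f []      _  = z≤n
peelRest-shrinks f (t ∷ H) H≤ = s≤s⁻¹ (begin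
    suc (sizes (peelRest (t ∷ H)))               ≤⟨ s≤s (m≤m+n _ (length H)) ⟩
    suc (sizes (peelRest (t ∷ H)) + length H)    ≡⟨ sym (+-suc _ (length H)) ⟩
    sizes (peelRest (t ∷ H)) + length (t ∷ H)    ≡⟨ CutSpec.sizes-rest (peel-spec (t ∷ H)) ⟩
    sizes (t ∷ H)                                ≤⟨ H≤ ⟩
    suc f                                        ∎)
  where open ≤-Reasoning

-- The level transform (with fuel f ≥ sizes F): transform the lower
-- generations recursively, then nest the top generation into them.
Φ : ℕ → List Tree → List Tree
Φ zero    F = []
Φ (suc f) F = fill (degs F) (Φ f (kids F))

Ψ : ℕ → List Tree → List Tree
Ψ zero    H = []
Ψ (suc f) H = glue (peelDegs H) (Ψ f (peelRest H))

length-Φ : (f : ℕ) (F : List Tree) → sizes F ≤ f → length (Φ f F) ≡ length F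
length-Φ zero    F F≤ rewrite sizes-zero F F≤ = refl
length-Φ (suc f) F F≤ = trans
  (length-fill-exact (degs F) (Φ f (kids F))
    (trans (sym (length-kids F)) (sym (length-Φ f (kids F) (kids-shrinks f F F≤)))))
  (length-map rootDegree F)

sizes-Φ : (f : ℕ) (F : List Tree) → sizes F ≤ f → sizes (Φ f F) ≡ sizes F
sizes-Φ zero    F F≤ rewrite sizes-zero F F≤ = refl
sizes-Φ (suc f) F F≤ = trans (sizes-fill (degs F) (Φ f (kids F)))
  (trans (cong₂ _+_ (length-map rootDegree F) (sizes-Φ f (kids F) (kids-shrinks f F F≤)))
         (sym (sizes-kids F)))

Ψ-preserves : (f : ℕ) (H : List Tree) → sizes H ≤ f →
              (length (Ψ f H) ≡ length H) × (sizes (Ψ f H) ≡ sizes H)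
Ψ-preserves zero    H H≤ rewrite sizes-zero H H≤ = refl , refl
Ψ-preserves (suc f) H H≤ =
    trans (length-glue (peelDegs H) G) P.length-cut
  , (begin
      sizes (glue (peelDegs H) G)          ≡⟨ sizes-glue (peelDegs H) G (trans (sum-peelDegs H) (sym (proj₁ IH))) ⟩
      length (peelDegs H) + sizes G        ≡⟨ cong₂ _+_ P.length-cut (proj₂ IH) ⟩
      length H + sizes (peelRest H)        ≡⟨ +-comm (length H) _ ⟩
      sizes (peelRest H) + length H        ≡⟨ P.sizes-rest ⟩
      sizes H                              ∎)
  where
  open ≡-Reasoning
  module P = CutSpec (peel-spec H)
  G = Ψ f (peelRest H)
  IH = Ψ-preserves f (peelRest H) (peelRest-shrinks f H H≤)

Ψ-Φ : (f : ℕ) (F : List Tree) → sizes F ≤ f → Ψ f (Φ f F) ≡ F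
Ψ-Φ zero    F F≤ = sym (sizes-zero F F≤)
Ψ-Φ (suc f) F F≤ = begin
    glue (peelDegs (fill (degs F) R)) (Ψ f (peelRest (fill (degs F) R)))
      ≡⟨ cong₂ (λ c R′ → glue c (Ψ f R′)) (cong proj₁ peel≡) (cong proj₂ peel≡) ⟩
    glue (degs F) (Ψ f (Φ f (kids F)))
      ≡⟨ cong (glue (degs F)) (Ψ-Φ f (kids F) (kids-shrinks f F F≤)) ⟩
    glue (degs F) (kids F)
      ≡⟨ glue-degs-kids F ⟩
    F ∎
  where
  open ≡-Reasoning
  R = Φ f (kids F)
  degs≡R : sum (degs F) ≡ length R
  degs≡R = trans (sym (length-kids F)) (sym (length-Φ f (kids F) (kids-shrinks f F F≤)))
  peel≡ : cut (length (fill (degs F) R)) (fill (degs F) R) ≡ (degs F , R)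
  peel≡ = trans (cong (λ k → cut k (fill (degs F) R)) (length-fill-exact (degs F) R degs≡R))
                (cut-fill (degs F) R (≤-reflexive degs≡R))

Φ-Ψ : (f : ℕ) (H : List Tree) → sizes H ≤ f → Φ f (Ψ f H) ≡ H
Φ-Ψ zero    H H≤ = sym (sizes-zero H H≤)
Φ-Ψ (suc f) H H≤ = begin
    fill (degs (glue c G)) (Φ f (kids (glue c G)))   ≡⟨ cong₂ fill (degs-glue c G c≡G) (cong (Φ f) (kids-glue c G c≡G)) ⟩
    fill c (Φ f (Ψ f R))                              ≡⟨ cong (fill c) (Φ-Ψ f R R≤) ⟩
    fill c R                                          ≡⟨ CutSpec.fill-cut (peel-spec H) ⟩
    H                                                 ∎
  where
  open ≡-Reasoning
  c = peelDegs H
  R = peelRest H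
  R≤ = peelRest-shrinks f H H≤
  G = Ψ f R
  c≡G : sum c ≡ length G
  c≡G = trans (sum-peelDegs H) (sym (proj₁ (Ψ-preserves f R R≤)))

φ : List Tree → List Tree
φ F = Φ (sizes F) F

ψ : List Tree → List Tree
ψ H = Ψ (sizes H) H

ψ-φ : (F : List Tree) → ψ (φ F) ≡ F
ψ-φ F rewrite sizes-Φ (sizes F) F ≤-refl = Ψ-Φ (sizes F) F ≤-refl

φ-ψ : (H : List Tree) → φ (ψ H) ≡ H
φ-ψ H rewrite proj₂ (Ψ-preserves (sizes H) H ≤-refl) = Φ-Ψ (sizes H) H ≤-refl

spine : List Tree → ℕ
spine []             = 0
spine (t ∷ u ∷ ts)   = spine (u ∷ ts)
spine (node C ∷ []) = suc (spine C)

spine-cons : (t : Tree) (X : List Tree) → 1 ≤ length X → spine (t ∷ X) ≡ spine X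
spine-cons t (u ∷ X) _ = refl

spine-++ : (A B : List Tree) → 1 ≤ length B → spine (A ++ B) ≡ spine B
spine-++ []      B B≥ = refl
spine-++ (t ∷ A) B B≥ = trans (spine-cons t (A ++ B) (≤-trans B≥ (length-++-≤ʳ B {A}))) (spine-++ A B B≥)

-- A graft that leaves some trees behind does not touch the last tree ...
spine-graft-inner : (x : ℕ) (R : List Tree) → x < length R → spine (graft x R) ≡ spine R
spine-graft-inner x R x< = begin
    spine (node (take x R) ∷ drop x R)   ≡⟨ spine-cons _ (drop x R) rest≥ ⟩
    spine (drop x R)                     ≡⟨ sym (spine-++ (take x R) (drop x R) rest≥) ⟩
    spine (take x R ++ drop x R)         ≡⟨ cong spine (take++drop≡id x R) ⟩
    spine R                              ∎
  where
  open ≡-Reasoning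
  rest≥ : 1 ≤ length (drop x R)
  rest≥ = ≤-trans (m<n⇒0<n∸m x<) (≤-reflexive (sym (length-drop x R)))

-- ... so the spine of fill c T is that of T as long as some tree of T is
-- never adopted.
fill-spine : (c : List ℕ) (T : List Tree) → sum c < length T → spine (fill c T) ≡ spine T
fill-spine []      T _  = refl
fill-spine (x ∷ c) T c< =
  trans (spine-graft-inner x (fill c T) (fill-room (suc x) c T c<))
        (fill-spine c T (≤-trans (s≤s (m≤n+m (sum c) x)) c<))

indicator : Bool → ℕ
indicator true  = 1
indicator false = 0

-- hasChild (node K) says that the list K is non-empty.
hasChild-++ : (K C : List Tree) → hasChild (node (K ++ C)) ≡ hasChild (node K) ∨ hasChild (node C)
hasChild-++ []      C = refl
hasChild-++ (k ∷ K) C = refl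

-- Grafting the top generation onto the lower generations R, when the
-- grafted roots other than the last have K children in total.  The spine
-- grows by one exactly when K is empty, i.e. the last root adopts all of R.
spine-graft-level : (K C R : List Tree) → length R ≡ length K + length C →
                    spine (graft (length C) R) ≡ indicator (not (hasChild (node K))) + spine R
spine-graft-level []      C R R≡ =
  cong₂ (λ C′ D → spine (node C′ ∷ D))
        (take-all (length C) R (≤-reflexive R≡)) (drop-all (length C) R (≤-reflexive R≡))
spine-graft-level (k ∷ K) C R R≡ =
  spine-graft-inner (length C) R (≤-trans (s≤s (m≤n+m (length C) (length K))) (≤-reflexive (sym R≡)))

countUpTo : (ℕ → Bool) → ℕ → ℕ
countUpTo P zero    = 0
countUpTo P (suc N) = indicator (P 0) + countUpTo (λ d → P (suc d)) N

length-filter-applyUpTo : (P : ℕ → Bool) (g : ℕ → ℕ) (N : ℕ) →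
                          length (filterᵇ P (applyUpTo g N)) ≡ countUpTo (λ d → P (g d)) N
length-filter-applyUpTo P g zero = refl
length-filter-applyUpTo P g (suc N) with P (g 0)
... | true  = cong suc (length-filter-applyUpTo P (λ d → g (suc d)) N)
... | false = length-filter-applyUpTo P (λ d → g (suc d)) N

countUpTo-cong : (P Q : ℕ → Bool) (N : ℕ) → (∀ d → P d ≡ Q d) → countUpTo P N ≡ countUpTo Q N
countUpTo-cong P Q zero    P≡Q = refl
countUpTo-cong P Q (suc N) P≡Q =
  cong₂ _+_ (cong indicator (P≡Q 0)) (countUpTo-cong _ _ N (λ d → P≡Q (suc d)))

atDepthList-++ : (d : ℕ) (A B : List Tree) → atDepthList d (A ++ B) ≡ atDepthList d A ++ atDepthList d B
atDepthList-++ d []      B = refl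
atDepthList-++ d (t ∷ A) B =
  trans (cong (atDepth d t ++_) (atDepthList-++ d A B)) (sym (++-assoc (atDepth d t) _ _))

atDepthList-zero : (F : List Tree) → atDepthList 0 F ≡ F
atDepthList-zero []      = refl
atDepthList-zero (t ∷ F) = cong (t ∷_) (atDepthList-zero F)

atDepthList-suc : (d : ℕ) (F : List Tree) → atDepthList (suc d) F ≡ atDepthList d (kids F)
atDepthList-suc d []            = refl
atDepthList-suc d (node C ∷ F) =
  trans (cong (atDepthList d C ++_) (atDepthList-suc d F)) (sym (atDepthList-++ d C (kids F)))

crucialsUpTo : ℕ → List Tree → ℕ
crucialsUpTo N F = countUpTo (λ d → hasCrucial (atDepthList d F)) N

crucialsUpTo-step : (N : ℕ) (F : List Tree) →
                    crucialsUpTo (suc N) F ≡ indicator (hasCrucial F) + crucialsUpTo N (kids F)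
crucialsUpTo-step N F =
  cong₂ _+_ (cong (λ G → indicator (hasCrucial G)) (atDepthList-zero F))
            (countUpTo-cong _ _ N (λ d → cong hasCrucial (atDepthList-suc d F)))

-- The root of a planted tree is crucial iff it has a child; the other
-- crucial vertices are those of the forest of its subtrees.
crucialCount-node : (F : List Tree) →
                    crucialCount (node F) ≡ indicator (hasChild (node F)) + crucialsUpTo (sizes F) F
crucialCount-node F =
  trans (length-filter-applyUpTo (λ d → hasCrucial (atDepth d (node F))) (λ d → d) (suc (sizes F)))
        (cong (λ b → indicator b + crucialsUpTo (sizes F) F) (∧-identityʳ (hasChild (node F))))

allChildless-++ : (A B : List Tree) → allChildless (A ++ B) ≡ allChildless A ∧ allChildless B
allChildless-++ []                 B = refl
allChildless-++ (node []      ∷ A) B = allChildless-++ A B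
allChildless-++ (node (_ ∷ _) ∷ A) B = refl

allChildless-reverse : (A : List Tree) → allChildless (reverse A) ≡ allChildless A
allChildless-reverse []      = refl
allChildless-reverse (t ∷ A) = begin
    allChildless (reverse (t ∷ A))                           ≡⟨ cong allChildless (unfold-reverse t A) ⟩
    allChildless (reverse A ++ t ∷ [])                       ≡⟨ allChildless-++ (reverse A) (t ∷ []) ⟩
    allChildless (reverse A) ∧ (not (hasChild t) ∧ true)     ≡⟨ cong₂ _∧_ (allChildless-reverse A) (∧-identityʳ _) ⟩
    allChildless A ∧ not (hasChild t)                        ≡⟨ ∧-comm (allChildless A) _ ⟩
    not (hasChild t) ∧ allChildless A                        ∎
  where open ≡-Reasoning

allChildless-kids : (F : List Tree) → allChildless F ≡ not (hasChild (node (kids F)))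
allChildless-kids []                 = refl
allChildless-kids (node []      ∷ F) = allChildless-kids F
allChildless-kids (node (_ ∷ _) ∷ F) = refl

hasCrucial-snoc : (F C : List Tree) →
                  hasCrucial (F ∷ʳ node C) ≡ hasChild (node C) ∧ not (hasChild (node (kids F)))
hasCrucial-snoc F C rewrite reverse-++ F (node C ∷ []) =
  cong (hasChild (node C) ∧_) (trans (allChildless-reverse F) (allChildless-kids F))

Φ-snoc : (f : ℕ) (F C : List Tree) →
         Φ (suc f) (F ∷ʳ node C) ≡ fill (degs F) (graft (length C) (Φ f (kids F ++ C)))
Φ-snoc f F C = trans (cong₂ fill (map-++ rootDegree F (node C ∷ [])) (cong (Φ f) (kids-snoc F C)))
                     (fill-++ (degs F) (length C ∷ []) (Φ f (kids F ++ C)))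

spine-Φ-snoc : (f : ℕ) (F C : List Tree) → sizes (F ∷ʳ node C) ≤ suc f →
               spine (Φ (suc f) (F ∷ʳ node C))
                 ≡ indicator (not (hasChild (node (kids F)))) + spine (Φ f (kids F ++ C))
spine-Φ-snoc f F C F≤ = begin
    spine (Φ (suc f) (F ∷ʳ node C))                 ≡⟨ cong spine (Φ-snoc f F C) ⟩
    spine (fill (degs F) (graft (length C) R))      ≡⟨ fill-spine (degs F) (graft (length C) R) room ⟩
    spine (graft (length C) R)                      ≡⟨ spine-graft-level (kids F) C R length-R ⟩
    indicator (not (hasChild (node (kids F)))) + spine R ∎
  where
  open ≡-Reasoning
  G = kids F ++ C
  R = Φ f G
  length-R : length R ≡ length (kids F) + length C
  length-R = trans (length-Φ f G (subst (λ X → sizes X ≤ f) (kids-snoc F C) (kids-shrinks f (F ∷ʳ node C) F≤)))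
                   (length-++ (kids F))
  room : sum (degs F) < length (graft (length C) R)
  room = s≤s (≤-reflexive (begin
    sum (degs F)                               ≡⟨ sym (length-kids F) ⟩
    length (kids F)                            ≡⟨ sym (m+n∸n≡m (length (kids F)) (length C)) ⟩
    length (kids F) + length C ∸ length C      ≡⟨ cong (_∸ length C) (sym length-R) ⟩
    length R ∸ length C                        ≡⟨ sym (length-drop (length C) R) ⟩
    length (drop (length C) R)                 ∎))

crucialsUpTo-snoc : (N : ℕ) (F C : List Tree) →
                    crucialsUpTo (suc N) (F ∷ʳ node C)
                      ≡ indicator (hasChild (node C) ∧ not (hasChild (node (kids F))))
                        + crucialsUpTo N (kids F ++ C)
crucialsUpTo-snoc N F C = trans (crucialsUpTo-step N (F ∷ʳ node C))
  (cong₂ _+_ (cong indicator (hasCrucial-snoc F C)) (cong (crucialsUpTo N) (kids-snoc F C)))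

-- The bookkeeping of one level: with a = "F has grandchildren" and
-- b = "node C has children", the spine gains [¬a] + [a ∨ b] vertices while
-- the crucial count gains 1 (for the level above) + [b ∧ ¬a].
indicator-level : (a b : Bool) → indicator (not a) + indicator (a ∨ b) ≡ suc (indicator (b ∧ not a))
indicator-level true  true  = refl
indicator-level true  false = refl
indicator-level false true  = refl
indicator-level false false = refl

spine-Φ : (f : ℕ) (F : List Tree) → sizes F ≤ f →
          spine (Φ f F) ≡ indicator (hasChild (node F)) + crucialsUpTo f F
spine-Φ zero    []              _  = refl
spine-Φ zero    (node C ∷ F)   ()
spine-Φ (suc f) F F≤ with initLast F
... | []            = spine-Φ f [] z≤n
... | F′ ∷ʳ′ node C = begin
    spine (Φ (suc f) (F′ ∷ʳ node C))
      ≡⟨ spine-Φ-snoc f F′ C F≤ ⟩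
    indicator (not a) + spine (Φ f G)
      ≡⟨ cong (indicator (not a) +_) (spine-Φ f G G≤) ⟩
    indicator (not a) + (indicator (hasChild (node G)) + crucialsUpTo f G)
      ≡⟨ cong (λ x → indicator (not a) + (indicator x + crucialsUpTo f G)) (hasChild-++ (kids F′) C) ⟩
    indicator (not a) + (indicator (a ∨ b) + crucialsUpTo f G)
      ≡⟨ sym (+-assoc (indicator (not a)) _ _) ⟩
    indicator (not a) + indicator (a ∨ b) + crucialsUpTo f G
      ≡⟨ cong (_+ crucialsUpTo f G) (indicator-level a b) ⟩
    suc (indicator (b ∧ not a) + crucialsUpTo f G)
      ≡⟨ cong suc (sym (crucialsUpTo-snoc f F′ C)) ⟩
    suc (crucialsUpTo (suc f) (F′ ∷ʳ node C))
      ≡⟨ cong (λ x → indicator x + crucialsUpTo (suc f) (F′ ∷ʳ node C)) (sym nonEmpty) ⟩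
    indicator (hasChild (node (F′ ∷ʳ node C))) + crucialsUpTo (suc f) (F′ ∷ʳ node C) ∎
  where
  open ≡-Reasoning
  a = hasChild (node (kids F′))
  b = hasChild (node C)
  G = kids F′ ++ C
  G≤ : sizes G ≤ f
  G≤ = subst (λ X → sizes X ≤ f) (kids-snoc F′ C) (kids-shrinks f (F′ ∷ʳ node C) F≤)
  nonEmpty : hasChild (node (F′ ∷ʳ node C)) ≡ true
  nonEmpty = trans (hasChild-++ F′ (node C ∷ [])) (∨-zeroʳ (hasChild (node F′)))

crucialCount-φ : (F : List Tree) → crucialCount (node F) ≡ spine (φ F)
crucialCount-φ F = trans (crucialCount-node F) (sym (spine-Φ (sizes F) F ≤-refl))

init : {A : Set} → List A → List A
init []           = []
init (x ∷ [])     = []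
init (x ∷ y ∷ ys) = x ∷ init (y ∷ ys)

-- (a leaf stands in for the last element of the empty list)
lastTree : List Tree → Tree
lastTree []           = node []
lastTree (x ∷ [])     = x
lastTree (x ∷ y ∷ ys) = lastTree (y ∷ ys)

init-lastTree : (C : List Tree) → 1 ≤ length C → init C ∷ʳ lastTree C ≡ C
init-lastTree (x ∷ [])     _ = refl
init-lastTree (x ∷ y ∷ ys) _ = cong (x ∷_) (init-lastTree (y ∷ ys) (s≤s z≤n))

init-snoc : {A : Set} (C : List A) (d : A) → init (C ∷ʳ d) ≡ C
init-snoc []           d = refl
init-snoc (x ∷ [])     d = refl
init-snoc (x ∷ y ∷ ys) d = cong (x ∷_) (init-snoc (y ∷ ys) d)

lastTree-snoc : (C : List Tree) (d : Tree) → lastTree (C ∷ʳ d) ≡ d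
lastTree-snoc []           d = refl
lastTree-snoc (x ∷ [])     d = refl
lastTree-snoc (x ∷ y ∷ ys) d = lastTree-snoc (y ∷ ys) d

liftLast : List Tree → List Tree
liftLast []              = []
liftLast (t ∷ u ∷ ts)    = t ∷ liftLast (u ∷ ts)
liftLast (node C ∷ [])  = node (init C) ∷ lastTree C ∷ []

lowerLast : List Tree → List Tree
lowerLast []                  = []
lowerLast (t ∷ [])            = t ∷ []
lowerLast (t ∷ u ∷ v ∷ ts)    = t ∷ lowerLast (u ∷ v ∷ ts)
lowerLast (node C ∷ d ∷ [])  = node (C ∷ʳ d) ∷ []

record Lifted (H : List Tree) : Set where
  field
    sizes-lift  : sizes (liftLast H) ≡ sizes H
    spine-lift  : suc (spine (liftLast H)) ≡ spine H
    length-lift : length (liftLast H) ≡ suc (length H)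
    lower-lift  : lowerLast (liftLast H) ≡ H

lifted : (H : List Tree) → 2 ≤ spine H → Lifted H
lifted (node C ∷ []) H≥ = record
  { sizes-lift  = cong suc (begin
      sizes (init C) + (size (lastTree C) + 0)   ≡⟨ sym (sizes-++ (init C) (lastTree C ∷ [])) ⟩
      sizes (init C ∷ʳ lastTree C)               ≡⟨ cong sizes (init-lastTree C C≥) ⟩
      sizes C                                    ≡⟨ sym (+-identityʳ (sizes C)) ⟩
      sizes C + 0                                ∎)
  ; spine-lift  = cong suc (trans (sym (spine-++ (init C) (lastTree C ∷ []) (s≤s z≤n)))
                                  (cong spine (init-lastTree C C≥)))
  ; length-lift = refl
  ; lower-lift  = cong (λ C′ → node C′ ∷ []) (init-lastTree C C≥)
  }
  where
  open ≡-Reasoning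
  C≥ : 1 ≤ length C
  C≥ = nonEmpty C H≥
    where
    nonEmpty : (C : List Tree) → 2 ≤ spine (node C ∷ []) → 1 ≤ length C
    nonEmpty []      (s≤s ())
    nonEmpty (_ ∷ _) _ = s≤s z≤n
lifted (t ∷ u ∷ ts) H≥ = lifted-cons t u ts (lifted (u ∷ ts) H≥)
  where
  -- lifting happens inside the last tree, so a tree in front is carried along
  lifted-cons : (t u : Tree) (ts : List Tree) → Lifted (u ∷ ts) → Lifted (t ∷ u ∷ ts)
  lifted-cons t u ts L = record
    { sizes-lift  = cong (size t +_) L.sizes-lift
    ; spine-lift  = trans (cong suc (spine-cons t (liftLast (u ∷ ts)) L≥)) L.spine-lift
    ; length-lift = cong suc L.length-lift
    ; lower-lift  = trans (lowerLast-cons (liftLast (u ∷ ts)) L≥₂) (cong (t ∷_) L.lower-lift)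
    }
    where
    module L = Lifted L
    L≥₂ : 2 ≤ length (liftLast (u ∷ ts))
    L≥₂ = ≤-trans (s≤s (s≤s z≤n)) (≤-reflexive (sym L.length-lift))
    L≥ : 1 ≤ length (liftLast (u ∷ ts))
    L≥ = ≤-trans (s≤s z≤n) L≥₂
    lowerLast-cons : (X : List Tree) → 2 ≤ length X → lowerLast (t ∷ X) ≡ t ∷ lowerLast X
    lowerLast-cons (x ∷ [])    (s≤s ())
    lowerLast-cons (x ∷ y ∷ X) _ = refl

record Lowered (H : List Tree) : Set where
  field
    sizes-lower  : sizes (lowerLast H) ≡ sizes H
    spine-lower  : spine (lowerLast H) ≡ suc (spine H)
    length-lower : suc (length (lowerLast H)) ≡ length H
    lift-lower   : liftLast (lowerLast H) ≡ H

lowered : (H : List Tree) → 2 ≤ length H → Lowered H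
lowered (t ∷ [])          (s≤s ())
lowered (t ∷ u ∷ v ∷ ts)  _ = lowered-cons (lowered (u ∷ v ∷ ts) (s≤s (s≤s z≤n)))
  where
  lowered-cons : Lowered (u ∷ v ∷ ts) → Lowered (t ∷ u ∷ v ∷ ts)
  lowered-cons L = record
    { sizes-lower  = cong (size t +_) L.sizes-lower
    ; spine-lower  = trans (spine-cons t (lowerLast (u ∷ v ∷ ts)) L≥) L.spine-lower
    ; length-lower = cong suc L.length-lower
    ; lift-lower   = trans (liftLast-cons (lowerLast (u ∷ v ∷ ts)) L≥) (cong (t ∷_) L.lift-lower)
    }
    where
    module L = Lowered L
    L≥ : 1 ≤ length (lowerLast (u ∷ v ∷ ts))
    L≥ = s≤s⁻¹ (≤-trans (s≤s (s≤s z≤n)) (≤-reflexive (sym L.length-lower)))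
    liftLast-cons : (X : List Tree) → 1 ≤ length X → liftLast (t ∷ X) ≡ t ∷ liftLast X
    liftLast-cons (x ∷ X) _ = refl
lowered (node C ∷ d ∷ []) _ = record
  { sizes-lower  = trans (+-identityʳ _) (cong suc (sizes-++ C (d ∷ [])))
  ; spine-lower  = cong suc (spine-++ C (d ∷ []) (s≤s z≤n))
  ; length-lower = refl
  ; lift-lower   = cong₂ (λ C′ d′ → node C′ ∷ d′ ∷ []) (init-snoc C d) (lastTree-snoc C d)
  }

Σ-≡ : {A : Set} {P : A → Set} → (∀ {a} → Irrelevant (P a)) →
      {a a′ : A} {x : P a} {y : P a′} → a ≡ a′ → (a , x) ≡ (a′ , y)
Σ-≡ P-irr {a} {x = x} {y} refl = cong (a ,_) (P-irr x y)

restrict-↔ : {A B : Set} {P : A → Set} {Q : B → Set} →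
             (∀ {a} → Irrelevant (P a)) → (∀ {b} → Irrelevant (Q b)) →
             (f : A → B) (g : B → A) →
             (∀ a → P a → Q (f a)) → (∀ b → Q b → P (g b)) →
             (∀ a → P a → g (f a) ≡ a) → (∀ b → Q b → f (g b) ≡ b) →
             Σ A P ↔ Σ B Q
restrict-↔ P-irr Q-irr f g f-Q g-P gf fg =
  mk↔ₛ′ (λ (a , x) → f a , f-Q a x) (λ (b , y) → g b , g-P b y)
        (λ (b , y) → Σ-≡ Q-irr (fg b y)) (λ (a , x) → Σ-≡ P-irr (gf a x))

≡³-irrelevant : {a b c d e f : ℕ} → Irrelevant ((a ≡ b) × (c ≡ d) × (e ≡ f))
≡³-irrelevant (x₁ , x₂ , x₃) (y₁ , y₂ , y₃) =
  cong₂ _,_ (≡-irrelevant x₁ y₁) (cong₂ _,_ (≡-irrelevant x₂ y₂) (≡-irrelevant x₃ y₃))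

SpineForests : ℕ → ℕ → ℕ → Set
SpineForests p q n = Σ (List Tree) (λ H → (sizes H ≡ n) × (spine H ≡ p) × (length H ≡ q))

trees↔forests : (p q n : ℕ) → C p q n ↔ SpineForests p q n
trees↔forests p q n = restrict-↔ ≡³-irrelevant ≡³-irrelevant
    (λ t → φ (children t)) (λ H → node (ψ H)) to from ψφ (λ H _ → φ-ψ H)
  where
  to : (t : Tree) → (size t ≡ suc n) × (crucialCount t ≡ p) × (rootDegree t ≡ q) →
       (sizes (φ (children t)) ≡ n) × (spine (φ (children t)) ≡ p) × (length (φ (children t)) ≡ q)
  to (node F) (size≡ , crucial≡ , degree≡) =
      trans (sizes-Φ (sizes F) F ≤-refl) (suc-injective size≡)
    , trans (sym (crucialCount-φ F)) crucial≡
    , trans (length-Φ (sizes F) F ≤-refl) degree≡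
  from : (H : List Tree) → (sizes H ≡ n) × (spine H ≡ p) × (length H ≡ q) →
         (size (node (ψ H)) ≡ suc n) × (crucialCount (node (ψ H)) ≡ p) × (rootDegree (node (ψ H)) ≡ q)
  from H (sizes≡ , spine≡ , length≡) =
      cong suc (trans (proj₂ (Ψ-preserves (sizes H) H ≤-refl)) sizes≡)
    , trans (crucialCount-φ (ψ H)) (trans (cong spine (φ-ψ H)) spine≡)
    , trans (proj₁ (Ψ-preserves (sizes H) H ≤-refl)) length≡
  ψφ : (t : Tree) → (size t ≡ suc n) × (crucialCount t ≡ p) × (rootDegree t ≡ q) → node (ψ (φ (children t))) ≡ t
  ψφ (node F) _ = cong node (ψ-φ F)

shift : (p q n : ℕ) → SpineForests (suc (suc p)) (suc q) n ↔ SpineForests (suc p) (suc (suc q)) n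
shift p q n = restrict-↔ ≡³-irrelevant ≡³-irrelevant liftLast lowerLast to from
    (λ H (_ , spine≡ , _) → Lifted.lower-lift (lifted H (spine≥ H spine≡)))
    (λ H (_ , _ , length≡) → Lowered.lift-lower (lowered H (length≥ H length≡)))
  where
  spine≥ : (H : List Tree) → spine H ≡ suc (suc p) → 2 ≤ spine H
  spine≥ H spine≡ = ≤-trans (s≤s (s≤s z≤n)) (≤-reflexive (sym spine≡))
  length≥ : (H : List Tree) → length H ≡ suc (suc q) → 2 ≤ length H
  length≥ H length≡ = ≤-trans (s≤s (s≤s z≤n)) (≤-reflexive (sym length≡))
  to : (H : List Tree) → (sizes H ≡ n) × (spine H ≡ suc (suc p)) × (length H ≡ suc q) →
       (sizes (liftLast H) ≡ n) × (spine (liftLast H) ≡ suc p) × (length (liftLast H) ≡ suc (suc q))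
  to H (sizes≡ , spine≡ , length≡) =
    trans L.sizes-lift sizes≡ , suc-injective (trans L.spine-lift spine≡) , trans L.length-lift (cong suc length≡)
    where module L = Lifted (lifted H (spine≥ H spine≡))
  from : (H : List Tree) → (sizes H ≡ n) × (spine H ≡ suc p) × (length H ≡ suc (suc q)) →
         (sizes (lowerLast H) ≡ n) × (spine (lowerLast H) ≡ suc (suc p)) × (length (lowerLast H) ≡ suc q)
  from H (sizes≡ , spine≡ , length≡) =
    trans L.sizes-lower sizes≡ , trans L.spine-lower (cong suc spine≡) , suc-injective (trans L.length-lower length≡)
    where module L = Lowered (lowered H (length≥ H length≡))

toSpineOne : (p q n : ℕ) → SpineForests (suc p) (suc q) n ↔ SpineForests 1 (p + suc q) n
toSpineOne zero    q n = ↔-refl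
toSpineOne (suc p) q n = ↔-trans (shift p q n)
  (subst (λ m → SpineForests (suc p) (suc (suc q)) n ↔ SpineForests 1 m n) (+-suc p (suc q)) (toSpineOne p (suc q) n))

mainTheorem4 : (n p q p′ q′ : ℕ) → 1 ≤ n → 1 ≤ p → 1 ≤ q → 1 ≤ p′ → 1 ≤ q′ →
    p + q ≡ p′ + q′ → C p q n ↔ C p′ q′ n
mainTheorem4 n (suc p) (suc q) (suc p′) (suc q′) _ _ _ _ _ p+q≡p′+q′ =
  ↔-trans (trees↔forests (suc p) (suc q) n)
  (↔-trans (toSpineOne p q n)
  (subst (λ m → SpineForests 1 m n ↔ C (suc p′) (suc q′) n) (sym (suc-injective p+q≡p′+q′))
         (↔-sym (↔-trans (trees↔forests (suc p′) (suc q′) n) (toSpineOne p′ q′ n)))))
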